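{- The complete graphs $K_7$ and $K_9$ admit a $\mu$-simultaneous edge coloring for $\mu=2$ and for $\mu=3$.
   Context: $[l]=\{1,\ldots,l\}$. A $\mu$-simultaneous edge coloring of a graph $G$ is a $\mu$-tuple $(c_1,\ldots,c_\mu)$ of proper edge colorings $c_i:E(G)\to[l]$ (with a common color set $[l]$) such that (1) for every vertex $v$, the set $\{c_i(e): e \text{ incident to } v\}$ is the same for all $i$, and (2) $c_i(e)\neq c_j(e)$ for every edge $e$ and all $i\neq j$. -}

module Defs where

open import Level using (Level; 0ℓ)
open import Data.Nat using (ℕ)
open import Data.Fin using (Fin; _<_)
open import Data.Product using (Σ; ∃; _×_; _,_; proj₁; proj₂)
open import Data.Unit using (⊤)
open import Relation.Binary.PropositionalEquality using (_≡_; _≢_)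
open import Function.Bundles using (_⇔_)

record Graph : Set₁ where
  field
    n   : ℕ
    Adj : Fin n → Fin n → Set

open Graph public

-- Edges: unordered pairs {u,v} represented as u < v with u adjacent to v.
Edge : (G : Graph) → Set
Edge G = Σ (Fin (n G)) λ u → Σ (Fin (n G)) λ v → (u < v) × Adj G u v

K : ℕ → Graph
K m = record { n = m ; Adj = λ _ _ → ⊤ }

Incident : (G : Graph) → Fin (n G) → Edge G → Set
Incident G w (u , v , _) = (w ≡ u) Data.Sum.⊎ (w ≡ v)
  where import Data.Sum

Proper : (G : Graph) (l : ℕ) → (Edge G → Fin l) → Set
Proper G l c = ∀ (e f : Edge G) → e ≢ f →
  ∀ (w : Fin (n G)) → Incident G w e → Incident G w f → c e ≢ c f

ColorsAt : (G : Graph) (l : ℕ) → (Edge G → Fin l) → Fin (n G) → Fin l → Set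
ColorsAt G l c w k = ∃ λ (e : Edge G) → Incident G w e × (c e ≡ k)

record SimultaneousColoring (G : Graph) (μ l : ℕ) : Set where
  field
    col        : Fin μ → Edge G → Fin l
    proper     : ∀ i → Proper G l (col i)
    sameColors : ∀ i j (w : Fin (n G)) (k : Fin l) →
                   ColorsAt G l (col i) w k ⇔ ColorsAt G l (col j) w k
    distinct   : ∀ i j → i ≢ j → ∀ (e : Edge G) → col i e ≢ col j e

Admits : Graph → ℕ → Set
Admits G μ = ∃ λ (l : ℕ) → SimultaneousColoring G μ l

-- Colour K_m (m odd) by symmetric tables on ℤ_m: the edge {u,v} gets colour
-- T_i(u,v) = u + v + r_i(±(v − u)) with r_0 = 0.  A family of such tables gives a
-- simultaneous edge colouring as soon as, at every vertex w, each star
-- u ↦ T_i(w,u) is injective, all stars at w see the same set of colours, and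
-- distinct tables disagree off the diagonal.  These finitely many conditions are
-- checked by evaluation for explicit offsets r_1, r_2 when m = 7 and m = 9.
module Submission where

open import Defs
open import Data.Product using (_×_; Σ; ∃; _,_)
open import Data.Nat using (ℕ; _+_; _∸_; NonZero)
open import Data.Nat.DivMod using (_mod_)
open import Data.Fin using (Fin; toℕ; _<_; _≟_; inject₁)
open import Data.Fin.Properties using (all?; any?; <-irrelevant; <-cmp; <-asym; <⇒≢)
open import Data.Vec using (Vec; []; _∷_; lookup)
open import Data.Sum using (inj₁; inj₂)
open import Data.Unit using (tt)
open import Data.Empty using (⊥-elim)
open import Relation.Nullary using (Dec; ¬?)
open import Relation.Nullary.Decidable using (True; toWitness; map′; _×-dec_; _→-dec_)
open import Relation.Binary.PropositionalEquality
open import Relation.Binary.Definitions using (tri<; tri≈; tri>)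
open import Function.Bundles using (mk⇔)

module _ {m : ℕ} where

  other-endpoint : ∀ w (e : Edge (K m)) → Incident (K m) w e → Fin m
  other-endpoint w (a , b , _) (inj₁ _) = b
  other-endpoint w (a , b , _) (inj₂ _) = a

  other-endpoint-≢ : ∀ w e (w∈e : Incident (K m) w e) → other-endpoint w e w∈e ≢ w
  other-endpoint-≢ w (a , b , a<b , _) (inj₁ refl) = λ b≡a → <⇒≢ a<b (sym b≡a)
  other-endpoint-≢ w (a , b , a<b , _) (inj₂ refl) = <⇒≢ a<b

  edge-≡ : ∀ {a b a' b'} (a<b : a < b) (a'<b' : a' < b') → a ≡ a' → b ≡ b' →
           _≡_ {A = Edge (K m)} (a , b , a<b , tt) (a' , b' , a'<b' , tt)
  edge-≡ a<b a'<b' refl refl = cong (λ p → _ , _ , p , tt) (<-irrelevant a<b a'<b')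

  other-endpoint-injective : ∀ {w} e f (w∈e : Incident (K m) w e) (w∈f : Incident (K m) w f) →
                             other-endpoint w e w∈e ≡ other-endpoint w f w∈f → e ≡ f
  other-endpoint-injective (_ , _ , p , tt) (_ , _ , q , tt) (inj₁ refl) (inj₁ refl) b≡b' =
    edge-≡ p q refl b≡b'
  other-endpoint-injective (_ , _ , p , tt) (_ , _ , q , tt) (inj₁ refl) (inj₂ refl) refl =
    ⊥-elim (<-asym p q)
  other-endpoint-injective (_ , _ , p , tt) (_ , _ , q , tt) (inj₂ refl) (inj₁ refl) refl =
    ⊥-elim (<-asym p q)
  other-endpoint-injective (_ , _ , p , tt) (_ , _ , q , tt) (inj₂ refl) (inj₂ refl) a≡a' =
    edge-≡ p q a≡a' refl

  edge-towards : ∀ w u → u ≢ w →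
                 Σ (Edge (K m)) λ e → Σ (Incident (K m) w e) λ w∈e → other-endpoint w e w∈e ≡ u
  edge-towards w u u≢w with <-cmp w u
  ... | tri< w<u _ _ = (w , u , w<u , tt) , inj₁ refl , refl
  ... | tri≈ _ w≡u _ = ⊥-elim (u≢w (sym w≡u))
  ... | tri> _ _ u<w = (u , w , u<w , tt) , inj₂ refl , refl

Table : ℕ → Set
Table m = Fin m → Fin m → Fin m

module _ {m : ℕ} where

  Symmetric : Table m → Set
  Symmetric T = ∀ u v → T u v ≡ T v u

  StarInjective : Table m → Set
  StarInjective T = ∀ w u u' → u ≢ w → u' ≢ w → T w u ≡ T w u' → u ≡ u'

  StarColoursCovered : Table m → Table m → Set
  StarColoursCovered T T' = ∀ w u → u ≢ w → ∃ λ u' → u' ≢ w × T' w u' ≡ T w u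

  DisagreeOffDiagonal : Table m → Table m → Set
  DisagreeOffDiagonal T T' = ∀ a b → a ≢ b → T a b ≢ T' a b

  symmetric? : ∀ T → Dec (Symmetric T)
  symmetric? T = all? λ u → all? λ v → T u v ≟ T v u

  starInjective? : ∀ T → Dec (StarInjective T)
  starInjective? T = all? λ w → all? λ u → all? λ u' →
    ¬? (u ≟ w) →-dec ¬? (u' ≟ w) →-dec (T w u ≟ T w u') →-dec (u ≟ u')

  starColoursCovered? : ∀ T T' → Dec (StarColoursCovered T T')
  starColoursCovered? T T' = all? λ w → all? λ u →
    ¬? (u ≟ w) →-dec any? λ u' → ¬? (u' ≟ w) ×-dec (T' w u' ≟ T w u)

  disagreeOffDiagonal? : ∀ T T' → Dec (DisagreeOffDiagonal T T')
  disagreeOffDiagonal? T T' = all? λ a → all? λ b → ¬? (a ≟ b) →-dec ¬? (T a b ≟ T' a b)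

record IsSimultaneousTable {m μ : ℕ} (T : Fin μ → Table m) : Set where
  field
    symmetric           : ∀ i → Symmetric (T i)
    starInjective       : ∀ i → StarInjective (T i)
    starColoursCovered  : ∀ i j → StarColoursCovered (T i) (T j)
    disagreeOffDiagonal : ∀ i j → i ≢ j → DisagreeOffDiagonal (T i) (T j)

isSimultaneousTable? : ∀ {m μ} (T : Fin μ → Table m) → Dec (IsSimultaneousTable T)
isSimultaneousTable? T =
  map′ (λ (s , i , c , d) → record
         { symmetric = s ; starInjective = i ; starColoursCovered = c ; disagreeOffDiagonal = d })
       (λ S → let open IsSimultaneousTable S in
         symmetric , starInjective , starColoursCovered , disagreeOffDiagonal)
       (  (all? λ i → symmetric? (T i))
   ×-dec (all? λ i → starInjective? (T i))
   ×-dec (all? λ i → all? λ j → starColoursCovered? (T i) (T j))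
   ×-dec (all? λ i → all? λ j → ¬? (i ≟ j) →-dec disagreeOffDiagonal? (T i) (T j)))

module _ {m μ : ℕ} {T : Fin μ → Table m} (S : IsSimultaneousTable T) where
  open IsSimultaneousTable S

  edgeColour : Fin μ → Edge (K m) → Fin m
  edgeColour i (a , b , _) = T i a b

  edgeColour-from : ∀ i w e (w∈e : Incident (K m) w e) →
                    edgeColour i e ≡ T i w (other-endpoint w e w∈e)
  edgeColour-from i w (a , b , _) (inj₁ refl) = refl
  edgeColour-from i w (a , b , _) (inj₂ refl) = symmetric i a b

  edgeColour-proper : ∀ i → Proper (K m) m (edgeColour i)
  edgeColour-proper i e f e≢f w w∈e w∈f ce≡cf =
    e≢f (other-endpoint-injective e f w∈e w∈f
          (starInjective i w _ _ (other-endpoint-≢ w e w∈e) (other-endpoint-≢ w f w∈f)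
            (trans (sym (edgeColour-from i w e w∈e)) (trans ce≡cf (edgeColour-from i w f w∈f)))))

  colorsAt-covered : ∀ i j w k → ColorsAt (K m) m (edgeColour i) w k →
                     ColorsAt (K m) m (edgeColour j) w k
  colorsAt-covered i j w _ (e , w∈e , refl)
    with starColoursCovered i j w (other-endpoint w e w∈e) (other-endpoint-≢ w e w∈e)
  ... | u' , u'≢w , same with edge-towards w u' u'≢w
  ... | f , w∈f , towards-u' = f , w∈f , (begin
    edgeColour j f                      ≡⟨ edgeColour-from j w f w∈f ⟩
    T j w (other-endpoint w f w∈f)      ≡⟨ cong (T j w) towards-u' ⟩
    T j w u'                            ≡⟨ same ⟩
    T i w (other-endpoint w e w∈e)      ≡⟨ edgeColour-from i w e w∈e ⟨
    edgeColour i e                      ∎)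
    where open ≡-Reasoning

  tableColouring : SimultaneousColoring (K m) μ m
  tableColouring = record
    { col        = edgeColour
    ; proper     = edgeColour-proper
    ; sameColors = λ i j w k → mk⇔ (colorsAt-covered i j w k) (colorsAt-covered j i w k)
    ; distinct   = λ { i j i≢j (a , b , a<b , _) → disagreeOffDiagonal i j i≢j a b (<⇒≢ a<b) }
    }

admits-from-table : ∀ {m μ} (T : Fin μ → Table m) → True (isSimultaneousTable? T) → Admits (K m) μ
admits-from-table {m} T ok = m , tableColouring (toWitness ok)

-- The offset r is looked up at (v − u) mod m, so T is symmetric exactly when r(d) = r(m − d).
differenceTable : (m : ℕ) .{{_ : NonZero m}} → Vec ℕ m → Table m
differenceTable m r u v = (toℕ u + toℕ v + lookup r ((m + toℕ v ∸ toℕ u) mod m)) mod m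

offsets₇ : Fin 3 → Vec ℕ 7
offsets₇ Fin.zero                     = 0 ∷ 0 ∷ 0 ∷ 0 ∷ 0 ∷ 0 ∷ 0 ∷ []
offsets₇ (Fin.suc Fin.zero)           = 0 ∷ 2 ∷ 4 ∷ 1 ∷ 1 ∷ 4 ∷ 2 ∷ []
offsets₇ (Fin.suc (Fin.suc Fin.zero)) = 0 ∷ 5 ∷ 3 ∷ 6 ∷ 6 ∷ 3 ∷ 5 ∷ []

offsets₉ : Fin 3 → Vec ℕ 9
offsets₉ Fin.zero                     = 0 ∷ 0 ∷ 0 ∷ 0 ∷ 0 ∷ 0 ∷ 0 ∷ 0 ∷ 0 ∷ []
offsets₉ (Fin.suc Fin.zero)           = 0 ∷ 2 ∷ 6 ∷ 8 ∷ 2 ∷ 2 ∷ 8 ∷ 6 ∷ 2 ∷ []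
offsets₉ (Fin.suc (Fin.suc Fin.zero)) = 0 ∷ 3 ∷ 1 ∷ 4 ∷ 1 ∷ 1 ∷ 4 ∷ 1 ∷ 3 ∷ []

table₇ : Fin 3 → Table 7
table₇ i = differenceTable 7 (offsets₇ i)

table₉ : Fin 3 → Table 9
table₉ i = differenceTable 9 (offsets₉ i)

proposition2p10 : (Admits (K 7) 2 × Admits (K 7) 3) × (Admits (K 9) 2 × Admits (K 9) 3)
proposition2p10 =
    (admits-from-table (λ i → table₇ (inject₁ i)) _ , admits-from-table table₇ _)
  , (admits-from-table (λ i → table₉ (inject₁ i)) _ , admits-from-table table₉ _)
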